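{- Let $k,l'$ be positive integers with $l'<k$, and let $n\ge l'$. Then \[ f(n,k,n-l') \le f(n,l',n-l')+La(n,P_{k-l'+1,2^{l'}}). \]
   Context: $[n]=\{1,\dots,n\}$. A chain of length $m$ is a sequence of sets $F_1\subsetneq\dots\subsetneq F_m$; a family is $k$-Sperner if it contains no chain of length $k+1$. For a family $\mathcal{F}$ and a set $X$, $\mathcal{F}|_X=\{F\cap X:F\in\mathcal{F}\}$. A family $\mathcal{F}\subseteq 2^{[n]}$ is $l$-trace $k$-Sperner if $\mathcal{F}|_L$ is $k$-Sperner for every $l$-element $L\subseteq[n]$. $f(n,k,l)$ denotes the maximum size of an $l$-trace $k$-Sperner family $\mathcal{F}\subseteq 2^{[n]}$. A family $\mathcal{F}$ contains a poset $P$ if there is an injective map $\iota:P\to\mathcal{F}$ such that $p\le_P q$ implies $\iota(p)\subseteq\iota(q)$; otherwise $\mathcal{F}$ is $P$-free. $La(n,P)$ is the maximum size of a $P$-free family $\mathcal{F}\subseteq 2^{[n]}$. For positive integers $h,c$, $T_{h,c}$ is the rooted tree with $h$ levels (so its longest root-to-leaf path has $h$ vertices) in which every non-leaf vertex has exactly $c$ children and all leaves are at level $h$; $P_{h,c}$ is the poset on the vertices of $T_{h,c}$ in which $p\le q$ iff $q$ lies on the path from $p$ to the root (so the root is the maximum element, and the Hasse diagram of $P_{h,c}$ is $T_{h,c}$ with arcs directed towards the root). -}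

module Defs where

open import Data.Nat using (ℕ; zero; suc; _≤_)
open import Data.Fin using (Fin)
open import Data.Fin.Subset using (Subset; _⊆_; _⊂_; _∩_; ∣_∣)
open import Data.List using (List; length)
open import Data.List.Membership.Propositional as LM using ()
open import Data.List.Relation.Unary.All using (All)
open import Data.List.Relation.Unary.Unique.Propositional using (Unique)
open import Data.List.Relation.Unary.Linked using (Linked)
open import Data.Product using (Σ; ∃; _×_)
open import Relation.Binary.PropositionalEquality using (_≡_)
open import Relation.Nullary using (¬_)
open import Function.Definitions using (Injective)

-- A family of subsets of [n] is represented by a duplicate-free list
-- (Unique is imposed wherever sizes are compared); its size is the length.
Family : ℕ → Set
Family n = List (Subset n)

HasChain : {n : ℕ} → (Subset n → Set) → ℕ → Set
HasChain {n} P m =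
  Σ (List (Subset n)) λ c → (length c ≡ m) × All P c × Linked _⊂_ c

KSperner : {n : ℕ} → (Subset n → Set) → ℕ → Set
KSperner P k = ¬ HasChain P (suc k)

Trace : {n : ℕ} → Family n → Subset n → Subset n → Set
Trace F X S = ∃ λ G → (G LM.∈ F) × (S ≡ G ∩ X)

TraceSperner : (n k l : ℕ) → Family n → Set
TraceSperner n k l F = (L : Subset n) → ∣ L ∣ ≡ l → KSperner (Trace F L) k

IsMaxSize : (n : ℕ) → (Family n → Set) → ℕ → Set
IsMaxSize n Q m =
  (∃ λ F → Unique F × Q F × length F ≡ m) ×
  ((F : Family n) → Unique F → Q F → length F ≤ m)

-- Vertices of T_{h,c}: words over Fin c of length < h (the word records the
-- sequence of children chosen from the root; the empty word is the root).
data Vertex (c : ℕ) : ℕ → Set where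
  root : {h : ℕ} → Vertex c (suc h)
  _∷_  : {h : ℕ} → Fin c → Vertex c h → Vertex c (suc h)

-- Order of P_{h,c}: p ≼ q iff q lies on the path from p to the root,
-- i.e. the word of q is a prefix of the word of p.
data _≼_ {c : ℕ} : {h : ℕ} → Vertex c h → Vertex c h → Set where
  ≼-root : {h : ℕ} {p : Vertex c (suc h)} → p ≼ root
  ≼-step : {h : ℕ} {p q : Vertex c h} (a : Fin c) → p ≼ q → (a ∷ p) ≼ (a ∷ q)

ContainsPoset : {n : ℕ} → Family n → (V : Set) → (V → V → Set) → Set
ContainsPoset {n} F V _≤V_ =
  Σ (V → Subset n) λ ι →
    Injective _≡_ _≡_ ι × ((v : V) → ι v LM.∈ F) ×
    ((p q : V) → p ≤V q → ι p ⊆ ι q)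

PFree : (n h c : ℕ) → Family n → Set
PFree n h c F = ¬ ContainsPoset F (Vertex c h) _≼_

module Submission where

-- Let F be an (n-l')-trace k-Sperner family, put m = k - l',
-- c = 2^l', and call G ∈ F a *top* if G is the image of the root of a copy
-- of P_{m+1,c} inside F.  Split F into its tops F₁ and the rest F₂.
--  * F₂ is P_{m+1,c}-free: the root of a copy in F₂ would be a top of F.
--  * F₁ is (n-l')-trace l'-Sperner.  Fix L with |L| = n-l', so |[n]∖L| = l'
--    and at most 2^l' = c distinct sets share a trace on L.  Hence in a copy
--    of P_{h+2,c} the root and its c children cannot all have the same
--    trace, so some child has a strictly smaller trace.  Descending m times
--    from a top G extends any chain of traces starting at G∩L downwards by
--    m sets; a chain of length l'+1 in F₁|_L would thus give a chain of
--    length k+1 in F|_L.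
-- Then |F| = |F₁| + |F₂| ≤ f(n,l',n-l') + La(n,P_{m+1,c}).  Being a top is
-- not decidable constructively, but the goal is a decidable inequality, so
-- the classical decidability of a predicate on the finite set 2^[n] may be
-- assumed under a double negation.

open import Defs
open import Data.Bool using (Bool; true; false)
open import Data.Bool.Properties using (∧-identityʳ)
open import Data.Empty using (⊥-elim)
open import Data.Fin using (Fin)
open import Data.Fin.Properties using (any?)
open import Data.Fin.Subset using (Subset; inside; outside; _∩_; ∁; ∣_∣; _⊆_; _⊂_)
open import Data.Fin.Subset.Properties using (_∈?_; _⊂?_; ⊆-antisym; x∈p∩q⁺; x∈p∩q⁻; ∣∁p∣≡n∸∣p∣)
open import Data.List using (List; []; _∷_; length; tabulate; filter)
open import Data.List.Properties using (length-tabulate)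
open import Data.List.Membership.Propositional using (_∈_)
open import Data.List.Membership.Propositional.Properties using (∈-filter⁻)
open import Data.List.Relation.Binary.Subset.Propositional using () renaming (_⊆_ to _⊆ˡ_)
open import Data.List.Relation.Binary.Subset.Propositional.Properties using (filter-⊆)
open import Data.List.Relation.Unary.All as All using (All; []; _∷_)
open import Data.List.Relation.Unary.All.Properties using (tabulate⁺)
open import Data.List.Relation.Unary.AllPairs using ([]; _∷_)
open import Data.List.Relation.Unary.Linked using (Linked; _∷_)
open import Data.List.Relation.Unary.Unique.Propositional using (Unique)
import Data.List.Relation.Unary.Unique.Propositional.Properties as Unique
open import Data.Nat using (ℕ; zero; suc; _+_; _∸_; _^_; _≤_; _<_; _≤?_; z≤n; s≤s)
open import Data.Nat.Properties using (+-suc; +-comm; +-identityʳ; +-mono-≤; ≤-trans; ≤-reflexive; 1+n≰n; m∸n+n≡m; m∸[m∸n]≡n; <⇒≤; module ≤-Reasoning)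
open import Data.Product using (Σ; ∃; _,_; proj₁; proj₂)
open import Data.Vec using ([]; _∷_; head)
open import Data.Vec.Properties using (∷-injectiveˡ; ∷-injectiveʳ)
open import Relation.Binary.PropositionalEquality using (_≡_; refl; sym; trans; cong; subst)
open import Relation.Nullary using (¬_; yes; no)
open import Relation.Nullary.Decidable.Core using (decidable-stable; ¬¬-excluded-middle)
open import Relation.Unary using (Decidable)
open import Relation.Unary.Properties using (∁?)

private
  variable
    n : ℕ

-- The tails of the members of Xs whose first coordinate is b; this is the
-- induction step that removes the first point of the ground set.
tailsWith : Bool → List (Subset (suc n)) → List (Subset n)
tailsWith b [] = []
tailsWith true  ((true  ∷ X) ∷ Xs) = X ∷ tailsWith true Xs
tailsWith true  ((false ∷ X) ∷ Xs) = tailsWith true Xs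
tailsWith false ((true  ∷ X) ∷ Xs) = tailsWith false Xs
tailsWith false ((false ∷ X) ∷ Xs) = X ∷ tailsWith false Xs

length-tailsWith : (Xs : List (Subset (suc n))) →
  length Xs ≡ length (tailsWith true Xs) + length (tailsWith false Xs)
length-tailsWith [] = refl
length-tailsWith ((true  ∷ X) ∷ Xs) = cong suc (length-tailsWith Xs)
length-tailsWith ((false ∷ X) ∷ Xs) =
  trans (cong suc (length-tailsWith Xs)) (sym (+-suc _ _))

length-tailsWith-const : (b : Bool) (Xs : List (Subset (suc n))) →
  All (λ X → head X ≡ b) Xs → length (tailsWith b Xs) ≡ length Xs
length-tailsWith-const b [] [] = refl
length-tailsWith-const true  ((true  ∷ X) ∷ Xs) (_ ∷ hs) = cong suc (length-tailsWith-const true Xs hs)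
length-tailsWith-const false ((false ∷ X) ∷ Xs) (_ ∷ hs) = cong suc (length-tailsWith-const false Xs hs)
length-tailsWith-const true  ((false ∷ X) ∷ Xs) (() ∷ _)
length-tailsWith-const false ((true  ∷ X) ∷ Xs) (() ∷ _)

tailsWith-all : {P : Subset (suc n) → Set} {Q : Subset n → Set} (b : Bool) →
  (∀ X → P (b ∷ X) → Q X) → (Xs : List (Subset (suc n))) →
  All P Xs → All Q (tailsWith b Xs)
tailsWith-all b f [] [] = []
tailsWith-all true  f ((true  ∷ X) ∷ Xs) (p ∷ ps) = f X p ∷ tailsWith-all true f Xs ps
tailsWith-all true  f ((false ∷ X) ∷ Xs) (p ∷ ps) = tailsWith-all true f Xs ps
tailsWith-all false f ((true  ∷ X) ∷ Xs) (p ∷ ps) = tailsWith-all false f Xs ps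
tailsWith-all false f ((false ∷ X) ∷ Xs) (p ∷ ps) = f X p ∷ tailsWith-all false f Xs ps

tailsWith-unique : (b : Bool) (Xs : List (Subset (suc n))) →
  Unique Xs → Unique (tailsWith b Xs)
tailsWith-unique b [] [] = []
tailsWith-unique true ((true ∷ X) ∷ Xs) (X∉ ∷ u) =
  tailsWith-all true (λ _ ne e → ne (cong (true ∷_) e)) Xs X∉ ∷ tailsWith-unique true Xs u
tailsWith-unique true ((false ∷ X) ∷ Xs) (_ ∷ u) = tailsWith-unique true Xs u
tailsWith-unique false ((true ∷ X) ∷ Xs) (_ ∷ u) = tailsWith-unique false Xs u
tailsWith-unique false ((false ∷ X) ∷ Xs) (X∉ ∷ u) =
  tailsWith-all false (λ _ ne e → ne (cong (false ∷_) e)) Xs X∉ ∷ tailsWith-unique false Xs u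

-- At most 2^|[n]∖L| distinct sets have a given trace Y on L, since such a
-- set is determined by its part outside L.
sameTrace-bound : (L Y : Subset n) (Xs : List (Subset n)) → Unique Xs →
  All (λ X → X ∩ L ≡ Y) Xs → length Xs ≤ 2 ^ ∣ ∁ L ∣
sameTrace-bound [] [] [] _ _ = z≤n
sameTrace-bound [] [] (_ ∷ []) _ _ = s≤s z≤n
sameTrace-bound [] [] ([] ∷ [] ∷ _) ((≢ ∷ _) ∷ _) _ = ⊥-elim (≢ refl)
sameTrace-bound (outside ∷ L) (y ∷ Y) Xs distinct traces = begin
    length Xs                                   ≡⟨ length-tailsWith Xs ⟩
    length (tailsWith true Xs) + length (tailsWith false Xs)
                                                ≤⟨ +-mono-≤ (tails true) (tails false) ⟩
    2 ^ ∣ ∁ L ∣ + 2 ^ ∣ ∁ L ∣                   ≡⟨ cong (2 ^ ∣ ∁ L ∣ +_) (sym (+-identityʳ _)) ⟩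
    2 ^ ∣ ∁ (outside ∷ L) ∣                     ∎
  where
  open ≤-Reasoning
  tails : (b : Bool) → length (tailsWith b Xs) ≤ 2 ^ ∣ ∁ L ∣
  tails b = sameTrace-bound L Y (tailsWith b Xs) (tailsWith-unique b Xs distinct)
              (tailsWith-all b (λ _ → ∷-injectiveʳ) Xs traces)
sameTrace-bound (inside ∷ L) (y ∷ Y) Xs distinct traces = begin
    length Xs                   ≡⟨ sym (length-tailsWith-const y Xs (All.map first-bit traces)) ⟩
    length (tailsWith y Xs)     ≤⟨ sameTrace-bound L Y (tailsWith y Xs) (tailsWith-unique y Xs distinct)
                                     (tailsWith-all y (λ _ → ∷-injectiveʳ) Xs traces) ⟩
    2 ^ ∣ ∁ (inside ∷ L) ∣      ∎
  where
  open ≤-Reasoning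
  -- The first point lies in L, so the trace fixes the first coordinate.
  first-bit : {X : Subset (suc _)} → X ∩ (inside ∷ L) ≡ y ∷ Y → head X ≡ y
  first-bit {X = x ∷ _} e = trans (sym (∧-identityʳ x)) (∷-injectiveˡ e)

Copy : Family n → ℕ → ℕ → Set
Copy F c h = ContainsPoset F (Vertex c h) _≼_

top : {F : Family n} {c h : ℕ} → Copy F c (suc h) → Subset n
top (ι , _) = ι root

top-∈ : {F : Family n} {c h : ℕ} (cp : Copy F c (suc h)) → top cp ∈ F
top-∈ (_ , _ , mem , _) = mem root

IsTop : Family n → ℕ → ℕ → Subset n → Set
IsTop F c h G = Σ (Copy F c (suc h)) λ cp → top cp ≡ G

copy-mono : {F F′ : Family n} {c h : ℕ} → F ⊆ˡ F′ → Copy F c h → Copy F′ c h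
copy-mono F⊆F′ (ι , inj , mem , mono) = ι , inj , (λ v → F⊆F′ (mem v)) , mono

subcopy : {F : Family n} {c h : ℕ} → Copy F c (suc (suc h)) → Fin c → Copy F c (suc h)
subcopy {c = c} (ι , inj , mem , mono) a =
  (λ v → ι (a ∷ v)) , (λ e → ∷-cancel (inj e)) , (λ v → mem (a ∷ v)) ,
  (λ p q p≼q → mono _ _ (≼-step a p≼q))
  where
  ∷-cancel : {h : ℕ} {v w : Vertex c h} → Vertex._∷_ a v ≡ a ∷ w → v ≡ w
  ∷-cancel refl = refl

∩-monoˡ : {p q : Subset n} (L : Subset n) → p ⊆ q → p ∩ L ⊆ q ∩ L
∩-monoˡ {p = p} L p⊆q x∈ = let (x∈p , x∈L) = x∈p∩q⁻ p L x∈ in x∈p∩q⁺ (p⊆q x∈p , x∈L)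

⊆∧⊄⇒≡ : {p q : Subset n} → p ⊆ q → ¬ p ⊂ q → p ≡ q
⊆∧⊄⇒≡ {p = p} p⊆q p⊄q = ⊆-antisym p⊆q λ {x} x∈q →
  decidable-stable (x ∈? p) λ x∉p → p⊄q (p⊆q , x , x∈q , x∉p)

module Descent {F : Family n} {c : ℕ} (L : Subset n) (bound : 2 ^ ∣ ∁ L ∣ ≤ c) where

  -- Pigeonhole: the root and its c children are c+1 distinct members of F,
  -- more than 2^|[n]∖L| ≤ c, so they do not all share the root's trace.
  children-not-all-same-trace : {h : ℕ} (cp : Copy F c (suc (suc h))) →
    ¬ (∀ a → top (subcopy cp a) ∩ L ≡ top cp ∩ L)
  children-not-all-same-trace (ι , inj , _ , _) same =
    1+n≰n (≤-trans c+1≤size (≤-trans (sameTrace-bound L (ι root ∩ L) family distinct traces) bound))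
    where
    family : List (Subset n)
    family = ι root ∷ tabulate (λ a → ι (a ∷ root))
    root≢child : {a : Fin c} → ¬ (Vertex.root {c} {suc _} ≡ a ∷ root)
    root≢child ()
    child-injective : {a b : Fin c} → Vertex._∷_ a root ≡ b ∷ root → a ≡ b
    child-injective refl = refl
    distinct : Unique family
    distinct = tabulate⁺ (λ a e → root≢child (inj e)) ∷ Unique.tabulate⁺ (λ e → child-injective (inj e))
    traces : All (λ X → X ∩ L ≡ ι root ∩ L) family
    traces = refl ∷ tabulate⁺ same
    c+1≤size : suc c ≤ length family
    c+1≤size = ≤-reflexive (cong suc (sym (length-tabulate _)))

  strict-child : {h : ℕ} (cp : Copy F c (suc (suc h))) →
    ∃ λ a → top (subcopy cp a) ∩ L ⊂ top cp ∩ L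
  strict-child cp@(_ , _ , _ , mono) with any? (λ a → top (subcopy cp a) ∩ L ⊂? top cp ∩ L)
  ... | yes found = found
  ... | no none = ⊥-elim (children-not-all-same-trace cp λ a →
          ⊆∧⊄⇒≡ (∩-monoˡ L (mono _ _ ≼-root)) λ strict → none (a , strict))

  extend-down : (m : ℕ) (cp : Copy F c (suc m)) (ys : List (Subset n)) →
    Linked _⊂_ (top cp ∩ L ∷ ys) → All (Trace F L) ys →
    HasChain (Trace F L) (m + suc (length ys))
  extend-down zero cp ys chain inF = (top cp ∩ L ∷ ys) , refl , (top cp , top-∈ cp , refl) ∷ inF , chain
  extend-down (suc m) cp ys chain inF =
    subst (HasChain (Trace F L)) (+-suc m (suc (length ys)))
      (extend-down m (subcopy cp a) (top cp ∩ L ∷ ys) (smaller ∷ chain) ((top cp , top-∈ cp , refl) ∷ inF))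
    where
    a : Fin c
    a = proj₁ (strict-child cp)
    smaller : top (subcopy cp a) ∩ L ⊂ top cp ∩ L
    smaller = proj₂ (strict-child cp)

trace-mono : {F F′ : Family n} {L S : Subset n} → F′ ⊆ˡ F → Trace F′ L S → Trace F L S
trace-mono F′⊆F (G , G∈ , e) = G , F′⊆F G∈ , e

¬¬-decidable : (P : Subset n → Set) → ¬ ¬ Decidable P
¬¬-decidable {zero} P k = ¬¬-excluded-middle λ d → k λ { [] → d }
¬¬-decidable {suc n} P k =
  ¬¬-decidable (λ X → P (true ∷ X)) λ dt →
  ¬¬-decidable (λ X → P (false ∷ X)) λ df →
  k λ { (true ∷ X) → dt X ; (false ∷ X) → df X }

length-filter-partition : {A : Set} {P : A → Set} (P? : Decidable P) (xs : List A) →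
  length xs ≡ length (filter P? xs) + length (filter (∁? P?) xs)
length-filter-partition P? [] = refl
length-filter-partition P? (x ∷ xs) with P? x
... | yes _ = cong suc (length-filter-partition P? xs)
... | no _ = trans (cong suc (length-filter-partition P? xs)) (sym (+-suc _ _))

-- The non-tops contain no copy of P_{m+1,c}: its root would be a top.
others-free : {F : Family n} {c m : ℕ} (top? : Decidable (IsTop F c m)) →
  PFree n (suc m) c (filter (∁? top?) F)
others-free {F = F} top? cp =
  proj₂ (∈-filter⁻ (∁? top?) {xs = F} (top-∈ cp)) (copy-mono (filter-⊆ (∁? top?) F) cp , refl)

-- If every admissible L leaves at most c sets per trace, then the tops of
-- an L-trace (m+j)-Sperner family form an L-trace j-Sperner family: a chain
-- of j+1 traces of tops extends downwards to m+j+1 traces of members of F.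
tops-traceSperner : {F : Family n} {c m : ℕ} (top? : Decidable (IsTop F c m)) (j t : ℕ) →
  ((L : Subset n) → ∣ L ∣ ≡ t → 2 ^ ∣ ∁ L ∣ ≤ c) →
  TraceSperner n (m + j) t F → TraceSperner n j t (filter top? F)
tops-traceSperner top? j t bound spernerF L |L| ([] , () , _)
tops-traceSperner {n} {F} {c} {m} top? j t bound spernerF L |L| ((_ ∷ ys) , len , ((G , G∈ , refl) ∷ inTops) , chain) =
  spernerF L |L| (subst (HasChain (Trace F L)) (trans (cong (m +_) len) (+-suc m j))
    (from-top (proj₂ (∈-filter⁻ top? {xs = F} G∈)) chain))
  where
  from-top : {G : Subset n} → IsTop F c m G → Linked _⊂_ (G ∩ L ∷ ys) →
    HasChain (Trace F L) (m + suc (length ys))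
  from-top (cp , refl) chain =
    Descent.extend-down L (bound L |L|) m cp ys chain (All.map (trace-mono (filter-⊆ top? F)) inTops)

theorem3p1 : (k l' n : ℕ) → 0 < l' → l' < k → l' ≤ n →
    (a b c : ℕ) →
    IsMaxSize n (TraceSperner n k (n ∸ l')) a →
    IsMaxSize n (TraceSperner n l' (n ∸ l')) b →
    IsMaxSize n (PFree n (k ∸ l' + 1) (2 ^ l')) c →
    a ≤ b + c
theorem3p1 k l' n _ l'<k l'≤n _ b c ((F , distinct , spernerF , refl) , _) (_ , maxB) (_ , maxC) =
  decidable-stable (length F ≤? b + c) λ F≰b+c → ¬¬-decidable (IsTop F C m) λ top? → F≰b+c (begin
    length F                                             ≡⟨ length-filter-partition top? F ⟩
    length (filter top? F) + length (filter (∁? top?) F) ≤⟨ +-mono-≤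
      (maxB _ (Unique.filter⁺ top? distinct) (tops-traceSperner top? l' (n ∸ l') complement-bound
        (subst (λ i → TraceSperner n i (n ∸ l') F) k≡m+l' spernerF)))
      (maxC _ (Unique.filter⁺ (∁? top?) distinct) (subst (λ h → PFree n h C (filter (∁? top?) F)) (+-comm 1 m) (others-free top?))) ⟩
    b + c                                                ∎)
  where
  open ≤-Reasoning
  m C : ℕ
  m = k ∸ l'
  C = 2 ^ l'
  k≡m+l' : k ≡ m + l'
  k≡m+l' = sym (m∸n+n≡m (<⇒≤ l'<k))
  complement-bound : (L : Subset n) → ∣ L ∣ ≡ n ∸ l' → 2 ^ ∣ ∁ L ∣ ≤ C
  complement-bound L |L| =
    ≤-reflexive (cong (2 ^_) (trans (∣∁p∣≡n∸∣p∣ L) (trans (cong (n ∸_) |L|) (m∸[m∸n]≡n l'≤n))))
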